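{- For every integer $n\ge 9$, there is an injection from $P_5(0,n)\cup P_6(0,n)$ into $U_5(0,n)$.
   Context: Durfee symbol of a partition $\lambda$. Set $\lambda_k=0$ for $k>\ell(\lambda)$. Let $d=\max\{k:\lambda_k\ge k\}$, with $d=0$ for the empty partition. Then $$\alpha=(\lambda_1-d,\ldots,\lambda_d-d)',$$ the conjugate of the partition formed by the positive entries, and $$\beta=(\lambda_{d+1},\ldots,\lambda_{\ell(\lambda)}).$$ This is written $(\alpha,\beta)_d$. Parts beyond the length are taken to be $0$. $P(0,n)$ is the set of partitions of $n$ with rank $0$, equivalently $\ell(\alpha)=\ell(\beta)$. Two subsets of $P(0,n)$ are used: - $P_5(0,n)$: those with $d\ne 2$, $\beta_1=d$, and $\alpha_1=\alpha_2=\alpha_3=d$; - $P_6(0,n)$: those with $d=2$, $\beta_1=\beta_2=2$, and $\alpha_1=\alpha_2=\alpha_3=2$. $U(0,n)$ is the set of partitions of $n$ with Durfee symbol $(\gamma,\delta)_{d'}$ such that $\ell(\gamma)-\ell(\delta)\le 0$ and $\gamma_1\le d'-1$. $U_5(0,n)$ is the subset of $U(0,n)$ where $\ell(\gamma)=\ell(\delta)$ and $\delta_1=d'$. -}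

module Defs where

open import Data.Nat using (ℕ; zero; suc; _+_; _∸_; _≤_; _<_; _≤ᵇ_; _⊔_)
open import Data.Bool using (Bool; true; false; if_then_else_)
open import Data.Nat.ListAction using (sum)
open import Data.List using (List; []; _∷_; length; map; filter; drop; upTo; foldr)
open import Data.List.Relation.Unary.All using (All)
open import Data.List.Relation.Unary.Linked using (Linked)
open import Data.Nat.Properties using (_≤?_)
open import Data.Product using (Σ; _×_; proj₁)
open import Data.Sum using (_⊎_)
open import Relation.Binary.PropositionalEquality using (_≡_)
open import Relation.Nullary using (¬_)

record IsPartition (n : ℕ) (λs : List ℕ) : Set where
  field
    decreasing : Linked (λ a b → b ≤ a) λs
    positive   : All (λ a → 0 < a) λs
    total      : sum λs ≡ n

Partition : ℕ → Set
Partition n = Σ (List ℕ) (IsPartition n)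

-- 1-indexed part access, with parts beyond the length equal to 0
part : List ℕ → ℕ → ℕ
part []       _             = 0
part (x ∷ xs) zero          = 0     -- index 0 is unused
part (x ∷ xs) (suc zero)    = x
part (x ∷ xs) (suc (suc k)) = part xs (suc k)

countGE : ℕ → List ℕ → ℕ
countGE j xs = length (filter (λ x → j ≤? x) xs)

maxPart : List ℕ → ℕ
maxPart = foldr _⊔_ 0

conj : List ℕ → List ℕ
conj μ = map (λ j → countGE (suc j) μ) (upTo (maxPart μ))

-- Durfee size: d = max { k : λ_k ≥ k } (0 if no such k, e.g. the empty partition)
durfee : List ℕ → ℕ
durfee λs = foldr _⊔_ 0
  (map (λ k → if suc k ≤ᵇ part λs (suc k) then suc k else 0) (upTo (length λs)))

alpha : List ℕ → List ℕ
alpha λs = conj (filter (λ x → 1 ≤? x)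
                  (map (λ i → part λs (suc i) ∸ durfee λs) (upTo (durfee λs))))

beta : List ℕ → List ℕ
beta λs = drop (durfee λs) λs

RankZero : List ℕ → Set
RankZero λs = part λs 1 ≡ length λs

InP5 : List ℕ → Set
InP5 λs = RankZero λs × ¬ (durfee λs ≡ 2) × part (beta λs) 1 ≡ durfee λs
        × part (alpha λs) 1 ≡ durfee λs × part (alpha λs) 2 ≡ durfee λs
        × part (alpha λs) 3 ≡ durfee λs

InP6 : List ℕ → Set
InP6 λs = RankZero λs × durfee λs ≡ 2
        × part (beta λs) 1 ≡ 2 × part (beta λs) 2 ≡ 2
        × part (alpha λs) 1 ≡ 2 × part (alpha λs) 2 ≡ 2 × part (alpha λs) 3 ≡ 2

-- U(0,n): ℓ(γ) - ℓ(δ) ≤ 0 and γ_1 ≤ d' - 1 (as integers, i.e. γ_1 < d')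
InU : List ℕ → Set
InU λs = length (alpha λs) ≤ length (beta λs) × part (alpha λs) 1 < durfee λs

InU5 : List ℕ → Set
InU5 λs = InU λs × length (alpha λs) ≡ length (beta λs) × part (beta λs) 1 ≡ durfee λs

P56 : ℕ → Set
P56 n = Σ (Partition n) (λ p → InP5 (proj₁ p) ⊎ InP6 (proj₁ p))

U5 : ℕ → Set
U5 n = Σ (Partition n) (λ p → InU5 (proj₁ p))

-- an injection A ↪ B, injectivity measured on the underlying partitions
Injection : (n : ℕ) → Set
Injection n = Σ (P56 n → U5 n) (λ f →
  ∀ x y → proj₁ (proj₁ (f x)) ≡ proj₁ (proj₁ (f y)) → proj₁ (proj₁ x) ≡ proj₁ (proj₁ y))

-- A partition is determined by its Durfee symbol (α, β)_d, and every symbol with α and β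
-- descending, positive and bounded by d comes from a partition: its first d rows are d + α'_i
-- (α' the conjugate of α), followed by β. Its weight is d² + |α| + |β|, and rank 0 means
-- ℓ(α) = ℓ(β). A partition in P₅ ∪ P₆ has symbol (d d d α', d β') with d ≥ 1 since n > 0, and
-- the injection enlarges the Durfee square, preserving weight and ℓ(γ) = ℓ(δ):
--   d ≥ 3 :  (d d d α', d β')_d     ↦  (β', (d+1) ∪ α' ∪ (d-2))_{d+1},
--   d = 1 :  (1 1 1 α', 1 1 β'')_1  ↦  (β'', 2 α')_2,
--   d = 2 :  (2 2 2 α', 2 2 β')_2   ↦  (β' 1, 3 α' 1)_3.
-- The images are in U₅, as γ has parts at most d and δ starts with d + 1. The new Durfee size
-- (at least 4, 2 or 3) tells which case applied, and each case is undone by deleting what it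
-- added, so the map is injective.
module Submission where

open import Defs
open import Algebra.Properties.CommutativeSemigroup using (interchange)
open import Data.Bool using (true; false; if_then_else_; T)
open import Data.Empty using (⊥-elim)
open import Data.List
  using (List; []; _∷_; [_]; _++_; _∷ʳ_; length; map; filter; drop; replicate; upTo; applyUpTo)
open import Data.List.Properties
  using (length-applyUpTo; length-++; map-upTo; map-cong; length-filter; filter-accept; filter-reject; filter-all)
open import Data.List.Relation.Unary.All as All using (All; []; _∷_)
open import Data.List.Relation.Unary.All.Properties using (applyUpTo⁺₁; ++⁺; drop⁺; ∷ʳ⁺)
open import Data.List.Relation.Unary.Linked as Linked using (Linked; []; [-]; _∷_)
open import Data.List.Relation.Unary.Linked.Properties using (applyUpTo⁺₂; Linked⇒All)
open import Data.List.Relation.Binary.Permutation.Propositional using (↭-sym)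
open import Data.List.Relation.Binary.Permutation.Propositional.Properties using (All-resp-↭; ↭-length)
open import Data.Nat
open import Data.Fin using (Fin; zero; suc; toℕ)
open import Data.Nat.ListAction using (sum)
open import Data.Nat.ListAction.Properties using (sum-++; sum-↭)
open import Data.Nat.Properties
open import Data.Nat.Tactic.RingSolver using (solve-∀)
open import Data.Product using (∃-syntax; _×_; _,_; proj₁)
open import Data.Sum using (inj₁; inj₂)
open import Function using (flip; _∘_)
open import Relation.Binary.Properties.DecTotalOrder ≤-decTotalOrder using (≥-decTotalOrder)
open import Data.List.Sort.InsertionSort.Base ≥-decTotalOrder using (insert)
open import Data.List.Sort.InsertionSort.Properties ≥-decTotalOrder using (insert-↭; insert-↗)
open import Relation.Nullary using (¬_; yes; no; contradiction)
open import Relation.Binary.PropositionalEquality hiding ([_])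

Descending : List ℕ → Set
Descending = Linked _≥_

Positive : List ℕ → Set
Positive = All (0 <_)

-- Lemmas index parts as part xs (suc i), with i counted from 0; parts past the end are 0.

part≤head : ∀ {x xs} → Descending (x ∷ xs) → ∀ i → part xs (suc i) ≤ x
part≤head {xs = []}    _            _       = z≤n
part≤head {xs = _ ∷ _} (y≤x ∷ _)    zero    = y≤x
part≤head {xs = _ ∷ _} (y≤x ∷ desc) (suc i) = ≤-trans (part≤head desc i) y≤x

part-antitone : ∀ {xs} → Descending xs → ∀ {i j} → i ≤ j → part xs (suc j) ≤ part xs (suc i)
part-antitone {[]}    _    _                         = z≤n
part-antitone {_ ∷ _} _    {zero}  {zero}  _         = ≤-refl
part-antitone {_ ∷ _} desc {zero}  {suc j} _         = part≤head desc j
part-antitone {_ ∷ _} desc {suc i} {suc j} (s≤s i≤j) = part-antitone (Linked.tail desc) i≤j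

All≤⇒part≤ : ∀ {c xs} → All (_≤ c) xs → ∀ i → part xs (suc i) ≤ c
All≤⇒part≤ []                _       = z≤n
All≤⇒part≤ (x≤c ∷ _)         zero    = x≤c
All≤⇒part≤ (_ ∷ [])          (suc i) = z≤n
All≤⇒part≤ (_ ∷ all@(_ ∷ _)) (suc i) = All≤⇒part≤ all i

Descending⇒All≤ : ∀ {c xs} → Descending xs → part xs 1 ≤ c → All (_≤ c) xs
Descending⇒All≤ {xs = []}    _    _   = []
Descending⇒All≤ {xs = _ ∷ _} desc x≤c =
  All.map (λ y≤x → ≤-trans y≤x x≤c) (Linked⇒All (flip ≤-trans) ≤-refl desc)

Descending-∷ : ∀ {x xs} → part xs 1 ≤ x → Descending xs → Descending (x ∷ xs)
Descending-∷ {xs = []}    _   _    = [-]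
Descending-∷ {xs = _ ∷ _} y≤x desc = y≤x ∷ desc

Descending-++ : ∀ {xs ys} → Descending xs → Descending ys → All (part ys 1 ≤_) xs →
                Descending (xs ++ ys)
Descending-++ []           dys _          = dys
Descending-++ [-]          dys (y≤x ∷ []) = Descending-∷ y≤x dys
Descending-++ (y≤x ∷ dxs) dys (_ ∷ h)    = y≤x ∷ Descending-++ dxs dys h

Descending-drop : ∀ k {xs} → Descending xs → Descending (drop k xs)
Descending-drop zero            desc = desc
Descending-drop (suc k) {[]}    desc = desc
Descending-drop (suc k) {_ ∷ _} desc = Descending-drop k (Linked.tail desc)

Descending-∷ʳ : ∀ {x xs} → All (x ≤_) xs → Descending xs → Descending (xs ∷ʳ x)
Descending-∷ʳ []                _            = [-]
Descending-∷ʳ (x≤y ∷ [])        _            = x≤y ∷ [-]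
Descending-∷ʳ (_ ∷ all@(_ ∷ _)) (z≤y ∷ desc) = z≤y ∷ Descending-∷ʳ all desc

part-drop : ∀ k xs i → part (drop k xs) (suc i) ≡ part xs (suc (k + i))
part-drop zero    xs       i = refl
part-drop (suc k) []       i = refl
part-drop (suc k) (x ∷ xs) i = part-drop k xs i

0<part⇒<length : ∀ xs {i} → 0 < part xs (suc i) → i < length xs
0<part⇒<length (x ∷ xs)     {zero}  _   = s≤s z≤n
0<part⇒<length (x ∷ y ∷ ys) {suc i} pos = s≤s (0<part⇒<length (y ∷ ys) pos)

≡-byParts : ∀ {xs ys} → Positive xs → Positive ys →
            (∀ i → part xs (suc i) ≡ part ys (suc i)) → xs ≡ ys
≡-byParts []          []          _ = refl
≡-byParts []          (0<y ∷ _)   e = contradiction (sym (e 0)) (>⇒≢ 0<y)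
≡-byParts (0<x ∷ _)   []          e = contradiction (e 0) (>⇒≢ 0<x)
≡-byParts (_ ∷ posxs) (_ ∷ posys) e = cong₂ _∷_ (e 0) (≡-byParts posxs posys (e ∘ suc))

part-++ˡ : ∀ xs ys {i} → i < length xs → part (xs ++ ys) (suc i) ≡ part xs (suc i)
part-++ˡ (x ∷ xs)     ys {zero}  _         = refl
part-++ˡ (x ∷ y ∷ xs) ys {suc i} (s≤s i<n) = part-++ˡ (y ∷ xs) ys i<n

part-++ʳ : ∀ xs ys i → part (xs ++ ys) (suc (length xs + i)) ≡ part ys (suc i)
part-++ʳ []       ys i = refl
part-++ʳ (x ∷ xs) ys i = part-++ʳ xs ys i

replicate-prefix : ∀ k {c} xs → 0 < c → (∀ (i : Fin k) → part xs (suc (toℕ i)) ≡ c) →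
                   ∃[ ys ] xs ≡ replicate k c ++ ys
replicate-prefix zero    xs       _   _ = xs , refl
replicate-prefix (suc k) []       0<c h = contradiction (h zero) (<⇒≢ 0<c)
replicate-prefix (suc k) (x ∷ xs) 0<c h with replicate-prefix k xs 0<c (h ∘ suc)
... | ys , xs≡ = ys , cong₂ _∷_ (h zero) xs≡

part-applyUpTo : ∀ f M {i} → i < M → part (applyUpTo f M) (suc i) ≡ f i
part-applyUpTo f (suc M)       {zero}  _         = refl
part-applyUpTo f (suc (suc M)) {suc i} (s≤s i<M) = part-applyUpTo (f ∘ suc) (suc M) i<M

part-applyUpTo-≥ : ∀ f M {i} → M ≤ i → part (applyUpTo f M) (suc i) ≡ 0
part-applyUpTo-≥ f zero          _         = refl
part-applyUpTo-≥ f (suc zero)    {suc i} _ = refl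
part-applyUpTo-≥ f (suc (suc M)) {suc i} (s≤s M≤i) = part-applyUpTo-≥ (f ∘ suc) (suc M) M≤i

applyUpTo-cong : ∀ {f g : ℕ → ℕ} M → (∀ {i} → i < M → f i ≡ g i) → applyUpTo f M ≡ applyUpTo g M
applyUpTo-cong zero    _ = refl
applyUpTo-cong (suc M) h = cong₂ _∷_ (h z<s) (applyUpTo-cong M (λ i<M → h (s<s i<M)))

applyUpTo-part++drop : ∀ {M} xs → M ≤ length xs → applyUpTo (λ i → part xs (suc i)) M ++ drop M xs ≡ xs
applyUpTo-part++drop {zero}  xs       _         = refl
applyUpTo-part++drop {suc M} (x ∷ xs) (s≤s M≤n) = cong (x ∷_) (applyUpTo-part++drop xs M≤n)

drop-applyUpTo++ : ∀ (f : ℕ → ℕ) M ys → drop M (applyUpTo f M ++ ys) ≡ ys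
drop-applyUpTo++ f zero    ys = refl
drop-applyUpTo++ f (suc M) ys = drop-applyUpTo++ (f ∘ suc) M ys

sum-applyUpTo-const : ∀ c M → sum (applyUpTo (λ _ → c) M) ≡ M * c
sum-applyUpTo-const c zero    = refl
sum-applyUpTo-const c (suc M) = cong (c +_) (sum-applyUpTo-const c M)

sum-applyUpTo-+ : ∀ (f g : ℕ → ℕ) M →
                  sum (applyUpTo (λ i → f i + g i) M) ≡ sum (applyUpTo f M) + sum (applyUpTo g M)
sum-applyUpTo-+ f g zero    = refl
sum-applyUpTo-+ f g (suc M) = begin
  f 0 + g 0 + sum (applyUpTo (λ i → f (suc i) + g (suc i)) M)
    ≡⟨ cong (f 0 + g 0 +_) (sum-applyUpTo-+ (f ∘ suc) (g ∘ suc) M) ⟩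
  f 0 + g 0 + (sum (applyUpTo (f ∘ suc) M) + sum (applyUpTo (g ∘ suc) M))
    ≡⟨ interchange +-commutativeSemigroup (f 0) (g 0) _ _ ⟩
  f 0 + sum (applyUpTo (f ∘ suc) M) + (g 0 + sum (applyUpTo (g ∘ suc) M)) ∎
  where open ≡-Reasoning

part≤maxPart : ∀ xs i → part xs (suc i) ≤ maxPart xs
part≤maxPart []       i       = z≤n
part≤maxPart (x ∷ xs) zero    = m≤m⊔n x (maxPart xs)
part≤maxPart (x ∷ xs) (suc i) = ≤-trans (part≤maxPart xs i) (m≤n⊔m x (maxPart xs))

≤maxPart-applyUpTo : ∀ f M {i} → i < M → f i ≤ maxPart (applyUpTo f M)
≤maxPart-applyUpTo f M {i} i<M =
  subst (_≤ maxPart (applyUpTo f M)) (part-applyUpTo f M i<M) (part≤maxPart (applyUpTo f M) i)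

<maxPart-applyUpTo⇒∃ : ∀ f M {c} → c < maxPart (applyUpTo f M) → ∃[ i ] i < M × c < f i
<maxPart-applyUpTo⇒∃ f (suc M) c<max with ⊔-sel (f 0) (maxPart (applyUpTo (f ∘ suc) M))
... | inj₁ max≡f0 = 0 , z<s , subst (_ <_) max≡f0 c<max
... | inj₂ max≡rest with <maxPart-applyUpTo⇒∃ (f ∘ suc) M (subst (_ <_) max≡rest c<max)
...   | i , i<M , c<fi = suc i , s<s i<M , c<fi

remove : ℕ → List ℕ → List ℕ
remove x []       = []
remove x (y ∷ ys) with x ≟ y
... | yes _ = ys
... | no  _ = y ∷ remove x ys

remove-insert : ∀ x ys → remove x (insert x ys) ≡ ys
remove-insert x [] with x ≟ x
... | yes _   = refl
... | no  x≢x = contradiction refl x≢x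
-- insert x (y ∷ ys) branches on y ≤ᵇ x, the Boolean test of the order ≥.
remove-insert x (y ∷ ys) with y ≤ᵇ x in y≤ᵇx
... | true with x ≟ x
...   | yes _   = refl
...   | no  x≢x = contradiction refl x≢x
remove-insert x (y ∷ ys) | false with x ≟ y
...   | yes refl = ⊥-elim (subst T y≤ᵇx (≤⇒≤ᵇ (≤-refl {x})))
...   | no  _    = cong (y ∷_) (remove-insert x ys)

dropLast : List ℕ → List ℕ
dropLast []           = []
dropLast (x ∷ [])     = []
dropLast (x ∷ y ∷ ys) = x ∷ dropLast (y ∷ ys)

dropLast-∷ʳ : ∀ xs z → dropLast (xs ∷ʳ z) ≡ xs
dropLast-∷ʳ []           z = refl
dropLast-∷ʳ (x ∷ [])     z = refl
dropLast-∷ʳ (x ∷ y ∷ ys) z = cong (x ∷_) (dropLast-∷ʳ (y ∷ ys) z)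

-- Conjugation

countGE-accept : ∀ {j x} xs → j ≤ x → countGE j (x ∷ xs) ≡ suc (countGE j xs)
countGE-accept {j} xs j≤x = cong length (filter-accept (j ≤?_) j≤x)

countGE-reject : ∀ {j x} xs → j ≰ x → countGE j (x ∷ xs) ≡ countGE j xs
countGE-reject {j} xs j≰x = cong length (filter-reject (j ≤?_) j≰x)

countGE≤length : ∀ j xs → countGE j xs ≤ length xs
countGE≤length j = length-filter (j ≤?_)

countGE-all : ∀ {j xs} → All (j ≤_) xs → countGE j xs ≡ length xs
countGE-all {j} all = cong length (filter-all (j ≤?_) all)

countGE-none : ∀ {k} xs → (∀ i → part xs (suc i) < k) → countGE k xs ≡ 0
countGE-none []       _ = refl
countGE-none (x ∷ xs) h = trans (countGE-reject xs (<⇒≱ (h 0))) (countGE-none xs (h ∘ suc))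

countGE-antitone : ∀ xs {j k} → j ≤ k → countGE k xs ≤ countGE j xs
countGE-antitone []       _   = z≤n
countGE-antitone (x ∷ xs) {j} {k} j≤k with k ≤? x | j ≤? x
... | yes k≤x | yes j≤x rewrite countGE-accept xs k≤x | countGE-accept xs j≤x =
  s≤s (countGE-antitone xs j≤k)
... | yes k≤x | no  j≰x = contradiction (≤-trans j≤k k≤x) j≰x
... | no  k≰x | yes j≤x rewrite countGE-reject xs k≰x | countGE-accept xs j≤x =
  m≤n⇒m≤1+n (countGE-antitone xs j≤k)
... | no  k≰x | no  j≰x rewrite countGE-reject xs k≰x | countGE-reject xs j≰x = countGE-antitone xs j≤k

0<countGE : ∀ xs {k} → k < maxPart xs → 0 < countGE (suc k) xs
0<countGE (x ∷ xs) {k} k<max with suc k ≤? x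
... | yes k<x rewrite countGE-accept xs k<x = z<s
... | no  k≮x rewrite countGE-reject xs k≮x with ⊔-sel x (maxPart xs)
...   | inj₁ max≡x    = contradiction (subst (k <_) max≡x k<max) k≮x
...   | inj₂ max≡rest = 0<countGE xs (subst (k <_) max≡rest k<max)

countGE-applyUpTo : ∀ (f : ℕ → ℕ) M {j y} →
                    (∀ {k} → j ≤ f k → k < y) → (∀ {k} → k < y → j ≤ f k) →
                    countGE j (applyUpTo f M) ≡ M ⊓ y
countGE-applyUpTo f zero    _ _ = refl
countGE-applyUpTo f (suc M) {j} {zero} below _ = begin
  countGE j (f 0 ∷ applyUpTo (f ∘ suc) M) ≡⟨ countGE-reject (applyUpTo (f ∘ suc) M) (n≮0 ∘ below) ⟩
  countGE j (applyUpTo (f ∘ suc) M)       ≡⟨ countGE-applyUpTo (f ∘ suc) M (⊥-elim ∘ n≮0 ∘ below) (λ ()) ⟩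
  M ⊓ 0                                   ≡⟨ ⊓-zeroʳ M ⟩
  0                                       ∎
  where open ≡-Reasoning
countGE-applyUpTo f (suc M) {y = suc y} below above =
  trans (countGE-accept _ (above z<s))
        (cong suc (countGE-applyUpTo (f ∘ suc) M (s<s⁻¹ ∘ below) (above ∘ s<s)))

<countGE⇒<part : ∀ {l} → Descending l → ∀ {i j} → i < countGE (suc j) l → j < part l (suc i)
<countGE⇒<part {x ∷ xs} desc {i} {j} i<count with suc j ≤? x
... | no j≮x = contradiction (subst (i <_) count≡0 i<count) n≮0
  where count≡0 = trans (countGE-reject xs j≮x)
                        (countGE-none xs (λ k → ≤-<-trans (part≤head desc k) (≰⇒> j≮x)))
<countGE⇒<part {x ∷ xs} desc {zero}  {j} _ | yes j<x = j<x
<countGE⇒<part {x ∷ xs} desc {suc i} {j} i<count | yes j<x rewrite countGE-accept xs j<x =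
  <countGE⇒<part (Linked.tail desc) (s<s⁻¹ i<count)

<part⇒<countGE : ∀ {l} → Descending l → ∀ {i j} → j < part l (suc i) → i < countGE (suc j) l
<part⇒<countGE {x ∷ xs} desc {i} {j} j<part with suc j ≤? x
<part⇒<countGE {x ∷ xs} desc {zero}  j<x   | yes _ rewrite countGE-accept xs j<x = z<s
<part⇒<countGE {x ∷ xs} desc {suc i} j<part | yes j<x rewrite countGE-accept xs j<x =
  s<s (<part⇒<countGE (Linked.tail desc) j<part)
<part⇒<countGE {x ∷ xs} desc {zero}  j<x    | no j≮x = contradiction j<x j≮x
<part⇒<countGE {x ∷ xs} desc {suc i} j<part | no j≮x =
  contradiction (≤-trans j<part (part≤head desc i)) j≮x

columns : List ℕ → ℕ → List ℕ
columns l M = applyUpTo (λ k → countGE (suc k) l) M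

countGE-columns : ∀ {l} → Descending l → ∀ M i → countGE (suc i) (columns l M) ≡ M ⊓ part l (suc i)
countGE-columns desc M i = countGE-applyUpTo _ M (<countGE⇒<part desc) (<part⇒<countGE desc)

columns-Descending : ∀ l M → Descending (columns l M)
columns-Descending l M = applyUpTo⁺₂ _ M (λ k → countGE-antitone l (n≤1+n (suc k)))

countGE-∷ : ∀ j x xs → countGE j (x ∷ xs) ≡ countGE j [ x ] + countGE j xs
countGE-∷ j x xs with j ≤? x
... | yes j≤x rewrite countGE-accept xs j≤x | countGE-accept [] j≤x = refl
... | no  j≰x rewrite countGE-reject xs j≰x | countGE-reject [] j≰x = refl

sum-columns-[_] : ∀ x M → sum (columns [ x ] M) ≡ M ⊓ x
sum-columns-[ x ]     zero    = refl
sum-columns-[ zero ]  (suc M) = trans (sum-applyUpTo-const 0 (suc M)) (*-zeroʳ M)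
sum-columns-[ suc x ] (suc M) rewrite countGE-accept {1} {suc x} [] (s≤s z≤n) =
  cong suc (trans (cong sum (applyUpTo-cong M (λ _ → shift))) (sum-columns-[ x ] M))
  where
  shift : ∀ {i} → countGE (suc (suc i)) [ suc x ] ≡ countGE (suc i) [ x ]
  shift {i} with suc i ≤? x
  ... | yes i<x rewrite countGE-accept {suc (suc i)} [] (s≤s i<x) | countGE-accept [] i<x = refl
  ... | no  i≮x
    rewrite countGE-reject {suc (suc i)} {suc x} [] (i≮x ∘ s≤s⁻¹) | countGE-reject [] i≮x = refl

sum-columns : ∀ {a M} → All (_≤ M) a → sum (columns a M) ≡ sum a
sum-columns {[]}     {M} _ = trans (sum-applyUpTo-const 0 M) (*-zeroʳ M)
sum-columns {x ∷ xs} {M} (x≤M ∷ bounded) = begin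
  sum (columns (x ∷ xs) M)
    ≡⟨ cong sum (applyUpTo-cong M (λ {i} _ → countGE-∷ (suc i) x xs)) ⟩
  sum (applyUpTo (λ i → countGE (suc i) [ x ] + countGE (suc i) xs) M)
    ≡⟨ sum-applyUpTo-+ _ _ M ⟩
  sum (columns [ x ] M) + sum (columns xs M)
    ≡⟨ cong₂ _+_ (trans (sum-columns-[ x ] M) (m≥n⇒m⊓n≡n x≤M)) (sum-columns bounded) ⟩
  x + sum xs ∎
  where open ≡-Reasoning

conj≡columns : ∀ l → conj l ≡ columns l (maxPart l)
conj≡columns l = map-upTo (λ k → countGE (suc k) l) (maxPart l)

conj-Descending : ∀ l → Descending (conj l)
conj-Descending l rewrite conj≡columns l = columns-Descending l (maxPart l)

conj-Positive : ∀ l → Positive (conj l)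
conj-Positive l rewrite conj≡columns l = applyUpTo⁺₁ _ (maxPart l) (0<countGE l)

part-conj : ∀ l j → part (conj l) (suc j) ≡ countGE (suc j) l
part-conj l j rewrite conj≡columns l with j <? maxPart l
... | yes j<max = part-applyUpTo _ (maxPart l) j<max
... | no  j≮max = trans (part-applyUpTo-≥ _ (maxPart l) (≮⇒≥ j≮max))
                        (sym (countGE-none l (λ i → s≤s (≤-trans (part≤maxPart l i) (≮⇒≥ j≮max)))))

countGE-conj : ∀ {l} → Descending l → ∀ i → countGE (suc i) (conj l) ≡ part l (suc i)
countGE-conj {l} desc i rewrite conj≡columns l =
  trans (countGE-columns desc (maxPart l) i) (m≥n⇒m⊓n≡n (part≤maxPart l i))

conj-columns : ∀ {a M} → Descending a → Positive a → All (_≤ M) a → conj (columns a M) ≡ a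
conj-columns {a} {M} desc pos bounded = ≡-byParts (conj-Positive (columns a M)) pos (λ j → begin
  part (conj (columns a M)) (suc j) ≡⟨ part-conj (columns a M) j ⟩
  countGE (suc j) (columns a M)     ≡⟨ countGE-columns desc M j ⟩
  M ⊓ part a (suc j)                ≡⟨ m≥n⇒m⊓n≡n (All≤⇒part≤ bounded j) ⟩
  part a (suc j)                    ∎)
  where open ≡-Reasoning

maxPart-filter-positive : ∀ l → maxPart (filter (1 ≤?_) l) ≡ maxPart l
maxPart-filter-positive []          = refl
maxPart-filter-positive (zero ∷ l)  = maxPart-filter-positive l
maxPart-filter-positive (suc x ∷ l) = cong (suc x ⊔_) (maxPart-filter-positive l)

countGE-filter-positive : ∀ j l → countGE (suc j) (filter (1 ≤?_) l) ≡ countGE (suc j) l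
countGE-filter-positive j []          = refl
countGE-filter-positive j (zero ∷ l)  = countGE-filter-positive j l
countGE-filter-positive j (suc x ∷ l) with suc j ≤? suc x
... | yes j≤x rewrite countGE-accept (filter (1 ≤?_) l) j≤x | countGE-accept l j≤x =
  cong suc (countGE-filter-positive j l)
... | no  j≰x rewrite countGE-reject (filter (1 ≤?_) l) j≰x | countGE-reject l j≰x =
  countGE-filter-positive j l

conj-filter-positive : ∀ l → conj (filter (1 ≤?_) l) ≡ conj l
conj-filter-positive l rewrite maxPart-filter-positive l =
  map-cong (λ j → countGE-filter-positive j l) (upTo (maxPart l))

-- The Durfee size

≤-by-< : ∀ {m n} → (∀ {k} → k < m → k < n) → m ≤ n
≤-by-< {zero}  _ = z≤n
≤-by-< {suc m} h = h ≤-refl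

durfeeCandidate : List ℕ → ℕ → ℕ
durfeeCandidate λs k = if suc k ≤ᵇ part λs (suc k) then suc k else 0

durfee≡maxPart : ∀ λs → durfee λs ≡ maxPart (applyUpTo (durfeeCandidate λs) (length λs))
durfee≡maxPart λs = cong maxPart (map-upTo (durfeeCandidate λs) (length λs))

<durfee⇒<part : ∀ {λs} → Descending λs → ∀ {k} → k < durfee λs → k < part λs (suc k)
<durfee⇒<part {λs} desc {k} k<d
  with <maxPart-applyUpTo⇒∃ (durfeeCandidate λs) (length λs) (subst (k <_) (durfee≡maxPart λs) k<d)
... | m , _ , k<cand with suc m ≤ᵇ part λs (suc m) in test
...   | true  =
  ≤-trans k<cand (≤-trans (≤ᵇ⇒≤ (suc m) _ (subst T (sym test) _)) (part-antitone desc (s≤s⁻¹ k<cand)))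
...   | false = contradiction k<cand n≮0

<part⇒<durfee : ∀ λs {k} → k < part λs (suc k) → k < durfee λs
<part⇒<durfee λs {k} k<part = subst (k <_) (sym (durfee≡maxPart λs))
  (≤-trans (≤-reflexive (sym accepted))
           (≤maxPart-applyUpTo _ (length λs) (0<part⇒<length λs (≤-<-trans z≤n k<part))))
  where
  accepted : durfeeCandidate λs k ≡ suc k
  accepted with suc k ≤ᵇ part λs (suc k) in test
  ... | true  = refl
  ... | false = ⊥-elim (subst T test (≤⇒≤ᵇ k<part))

durfee-unique : ∀ {λs d} → Descending λs →
                (∀ {k} → k < d → k < part λs (suc k)) → (∀ {k} → k < part λs (suc k) → k < d) →
                durfee λs ≡ d
durfee-unique {λs} desc below above =
  ≤-antisym (≤-by-< (above ∘ <durfee⇒<part desc)) (≤-by-< (<part⇒<durfee λs ∘ below))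

durfee≤part : ∀ {λs} → Descending λs → ∀ {i} → i < durfee λs → durfee λs ≤ part λs (suc i)
durfee≤part {λs} desc {i} i<d with durfee λs | <durfee⇒<part desc {pred (durfee λs)}
... | suc D | corner = ≤-trans (corner ≤-refl) (part-antitone desc (s≤s⁻¹ i<d))

durfee≤length : ∀ {λs} → Descending λs → durfee λs ≤ length λs
durfee≤length {λs} desc = ≤-by-< (λ k<d → 0<part⇒<length λs (≤-<-trans z≤n (<durfee⇒<part desc k<d)))

part-after-durfee : ∀ λs → part λs (suc (durfee λs)) ≤ durfee λs
part-after-durfee λs = ≮⇒≥ (λ d<part → <-irrefl refl (<part⇒<durfee λs d<part))

-- Durfee symbols

Symbol : Set
Symbol = ℕ × List ℕ × List ℕ

symbol : List ℕ → Symbol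
symbol λs = durfee λs , alpha λs , beta λs

-- countGE (suc i) α is the i-th part of the conjugate of α.
fromSymbol : Symbol → List ℕ
fromSymbol (d , α , β) = applyUpTo (λ i → d + countGE (suc i) α) d ++ β

arm : ℕ → List ℕ → List ℕ
arm d λs = applyUpTo (λ i → part λs (suc i) ∸ d) d

arm-Descending : ∀ {λs} d → Descending λs → Descending (arm d λs)
arm-Descending d desc = applyUpTo⁺₂ _ d (λ k → ∸-monoˡ-≤ d (part-antitone desc (n≤1+n k)))

alpha≡conj-arm : ∀ λs → alpha λs ≡ conj (arm (durfee λs) λs)
alpha≡conj-arm λs =
  trans (cong (conj ∘ filter (1 ≤?_)) (map-upTo _ (durfee λs))) (conj-filter-positive (arm (durfee λs) λs))

fromSymbol-symbol : ∀ {λs} → Descending λs → fromSymbol (symbol λs) ≡ λs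
fromSymbol-symbol {λs} desc =
  trans (cong (_++ beta λs) (applyUpTo-cong d row≡part)) (applyUpTo-part++drop λs (durfee≤length desc))
  where
  open ≡-Reasoning
  d = durfee λs
  row≡part : ∀ {i} → i < d → d + countGE (suc i) (alpha λs) ≡ part λs (suc i)
  row≡part {i} i<d = begin
    d + countGE (suc i) (alpha λs)        ≡⟨ cong (λ α → d + countGE (suc i) α) (alpha≡conj-arm λs) ⟩
    d + countGE (suc i) (conj (arm d λs)) ≡⟨ cong (d +_) (countGE-conj (arm-Descending d desc) i) ⟩
    d + part (arm d λs) (suc i)           ≡⟨ cong (d +_) (part-applyUpTo _ d i<d) ⟩
    d + (part λs (suc i) ∸ d)             ≡⟨ m+[n∸m]≡n (durfee≤part desc i<d) ⟩
    part λs (suc i)                       ∎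

symbol-injective : ∀ {λs μs} → Descending λs → Descending μs → symbol λs ≡ symbol μs → λs ≡ μs
symbol-injective {λs} {μs} λs↓ μs↓ symbol≡ = begin
  λs                     ≡⟨ fromSymbol-symbol λs↓ ⟨
  fromSymbol (symbol λs) ≡⟨ cong fromSymbol symbol≡ ⟩
  fromSymbol (symbol μs) ≡⟨ fromSymbol-symbol μs↓ ⟩
  μs                     ∎
  where open ≡-Reasoning

record IsDurfeeSymbol (d : ℕ) (α β : List ℕ) : Set where
  field
    α-descending : Descending α
    α-positive   : Positive α
    α-bounded    : All (_≤ d) α
    β-descending : Descending β
    β-positive   : Positive β
    β-bounded    : All (_≤ d) β

symbol-isDurfeeSymbol : ∀ {λs} → Descending λs → Positive λs →
                        IsDurfeeSymbol (durfee λs) (alpha λs) (beta λs)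
symbol-isDurfeeSymbol {λs} desc pos = record
  { α-descending = α-descending
  ; α-positive   = subst Positive (sym (alpha≡conj-arm λs)) (conj-Positive (arm d λs))
  ; α-bounded    = Descending⇒All≤ α-descending (begin
      part (alpha λs) 1        ≡⟨ cong (λ α → part α 1) (alpha≡conj-arm λs) ⟩
      part (conj (arm d λs)) 1 ≡⟨ part-conj (arm d λs) 0 ⟩
      countGE 1 (arm d λs)     ≤⟨ countGE≤length 1 (arm d λs) ⟩
      length (arm d λs)        ≡⟨ length-applyUpTo _ d ⟩
      d                        ∎)
  ; β-descending = β-descending
  ; β-positive   = drop⁺ d pos
  ; β-bounded    = Descending⇒All≤ β-descending (begin
      part (beta λs) 1         ≡⟨ part-drop d λs 0 ⟩
      part λs (suc (d + 0))    ≡⟨ cong (λ m → part λs (suc m)) (+-identityʳ d) ⟩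
      part λs (suc d)          ≤⟨ part-after-durfee λs ⟩
      d                        ∎)
  }
  where
  open ≤-Reasoning
  d = durfee λs
  α-descending = subst Descending (sym (alpha≡conj-arm λs)) (conj-Descending (arm d λs))
  β-descending = Descending-drop d desc

length-fromSymbol : ∀ d α β → length (fromSymbol (d , α , β)) ≡ d + length β
length-fromSymbol d α β = trans (length-++ (applyUpTo _ d)) (cong (_+ length β) (length-applyUpTo _ d))

module _ {d α β} (s : IsDurfeeSymbol d α β) where
  open IsDurfeeSymbol s

  private
    row : ℕ → ℕ
    row i = d + countGE (suc i) α
    μ = fromSymbol (d , α , β)

  part-fromSymbol-row : ∀ {i} → i < d → part μ (suc i) ≡ row i
  part-fromSymbol-row i<d =
    trans (part-++ˡ (applyUpTo row d) β (subst (_ <_) (sym (length-applyUpTo row d)) i<d))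
          (part-applyUpTo row d i<d)

  part-fromSymbol-β : ∀ i → part μ (suc (d + i)) ≡ part β (suc i)
  part-fromSymbol-β i =
    subst (λ m → part μ (suc (m + i)) ≡ part β (suc i)) (length-applyUpTo row d)
          (part-++ʳ (applyUpTo row d) β i)

  fromSymbol-Descending : Descending μ
  fromSymbol-Descending = Descending-++
    (applyUpTo⁺₂ row d (λ k → +-monoʳ-≤ d (countGE-antitone α (n≤1+n (suc k)))))
    β-descending
    (applyUpTo⁺₁ row d (λ _ → ≤-trans (All≤⇒part≤ β-bounded 0) (m≤m+n d _)))

  fromSymbol-Positive : Positive μ
  fromSymbol-Positive =
    ++⁺ (applyUpTo⁺₁ row d (λ i<d → <-≤-trans (≤-<-trans z≤n i<d) (m≤m+n d _))) β-positive

  durfee-fromSymbol : durfee μ ≡ d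
  durfee-fromSymbol = durfee-unique fromSymbol-Descending below above
    where
    below : ∀ {k} → k < d → k < part μ (suc k)
    below k<d = <-≤-trans k<d (≤-trans (m≤m+n d _) (≤-reflexive (sym (part-fromSymbol-row k<d))))
    above : ∀ {k} → k < part μ (suc k) → k < d
    above {k} k<part with k <? d
    ... | yes k<d = k<d
    ... | no  k≮d = contradiction (<-≤-trans k<part part≤k) (<-irrefl refl)
      where
      part≤k : part μ (suc k) ≤ k
      part≤k = begin
        part μ (suc k)             ≡⟨ cong (λ m → part μ (suc m)) (sym (m+[n∸m]≡n (≮⇒≥ k≮d))) ⟩
        part μ (suc (d + (k ∸ d))) ≡⟨ part-fromSymbol-β (k ∸ d) ⟩
        part β (suc (k ∸ d))       ≤⟨ All≤⇒part≤ β-bounded (k ∸ d) ⟩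
        d                          ≤⟨ ≮⇒≥ k≮d ⟩
        k                          ∎
        where open ≤-Reasoning

  beta-fromSymbol : beta μ ≡ β
  beta-fromSymbol = trans (cong (λ m → drop m μ) durfee-fromSymbol) (drop-applyUpTo++ row d β)

  alpha-fromSymbol : alpha μ ≡ α
  alpha-fromSymbol = begin
    alpha μ                  ≡⟨ alpha≡conj-arm μ ⟩
    conj (arm (durfee μ) μ)  ≡⟨ cong (λ m → conj (arm m μ)) durfee-fromSymbol ⟩
    conj (arm d μ)           ≡⟨ cong conj (applyUpTo-cong d (λ i<d →
                                  trans (cong (_∸ d) (part-fromSymbol-row i<d)) (m+n∸m≡n d _))) ⟩
    conj (columns α d)       ≡⟨ conj-columns α-descending α-positive α-bounded ⟩
    α                        ∎
    where open ≡-Reasoning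

  symbol-fromSymbol : symbol μ ≡ (d , α , β)
  symbol-fromSymbol = cong₂ _,_ durfee-fromSymbol (cong₂ _,_ alpha-fromSymbol beta-fromSymbol)

  sum-fromSymbol : sum μ ≡ d * d + sum α + sum β
  sum-fromSymbol = begin
    sum (applyUpTo row d ++ β)
      ≡⟨ sum-++ (applyUpTo row d) β ⟩
    sum (applyUpTo row d) + sum β
      ≡⟨ cong (_+ sum β) (sum-applyUpTo-+ _ _ d) ⟩
    sum (applyUpTo (λ _ → d) d) + sum (columns α d) + sum β
      ≡⟨ cong₂ (λ x y → x + y + sum β) (sum-applyUpTo-const d d) (sum-columns α-bounded) ⟩
    d * d + sum α + sum β ∎
    where open ≡-Reasoning

  part₁-fromSymbol : 0 < d → part μ 1 ≡ d + length α
  part₁-fromSymbol 0<d = trans (part-fromSymbol-row 0<d) (cong (d +_) (countGE-all α-positive))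

isPartition-fromSymbol : ∀ {n d α β} → IsDurfeeSymbol d α β → d * d + sum α + sum β ≡ n →
                         IsPartition n (fromSymbol (d , α , β))
isPartition-fromSymbol s weight = record
  { decreasing = fromSymbol-Descending s
  ; positive   = fromSymbol-Positive s
  ; total      = trans (sum-fromSymbol s) weight
  }

symbol⇒InU5 : ∀ λs {d γ δ} → symbol λs ≡ (d , γ , δ) →
              length γ ≡ length δ → part γ 1 < d → part δ 1 ≡ d → InU5 λs
symbol⇒InU5 _ refl balanced γ₁<d δ₁≡d = (≤-reflexive balanced , γ₁<d) , balanced , δ₁≡d

record RankZeroSymbol (n d : ℕ) (α β : List ℕ) : Set where
  field
    isDurfeeSymbol : IsDurfeeSymbol d α β
    balanced       : length α ≡ length β
    weight         : d * d + sum α + sum β ≡ n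

rankZeroSymbol : ∀ {n λs} → IsPartition n λs → RankZero λs → 0 < durfee λs →
                 RankZeroSymbol n (durfee λs) (alpha λs) (beta λs)
rankZeroSymbol {n} {λs} isPartition rankZero 0<d = record
  { isDurfeeSymbol = s
  ; balanced       = +-cancelˡ-≡ d _ _ (begin
      d + length (alpha λs) ≡⟨ sym (part₁-fromSymbol s 0<d) ⟩
      part μ 1              ≡⟨ cong (λ l → part l 1) μ≡λs ⟩
      part λs 1             ≡⟨ rankZero ⟩
      length λs             ≡⟨ cong length (sym μ≡λs) ⟩
      length μ              ≡⟨ length-fromSymbol d (alpha λs) (beta λs) ⟩
      d + length (beta λs)  ∎)
  ; weight         = trans (sym (sum-fromSymbol s)) (trans (cong sum μ≡λs) total)
  }
  where
  open IsPartition isPartition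
  open ≡-Reasoning
  d = durfee λs
  μ = fromSymbol (symbol λs)
  s = symbol-isDurfeeSymbol decreasing positive
  μ≡λs = fromSymbol-symbol decreasing

0<durfee : ∀ {n λs} → IsPartition n λs → 0 < n → 0 < durfee λs
0<durfee {λs = []}     isPartition 0<n = contradiction (IsPartition.total isPartition) (<⇒≢ 0<n)
0<durfee {λs = x ∷ xs} isPartition _ with IsPartition.positive isPartition
... | 0<x ∷ _ = <part⇒<durfee (x ∷ xs) 0<x

-- The shifts

-- Left inverse of the shifts below; its last clause is never reached.
unshift : Symbol → Symbol
unshift (2 , γ , δ) = 1 , 1 ∷ 1 ∷ 1 ∷ drop 1 δ , 1 ∷ 1 ∷ γ
unshift (3 , γ , δ) = 2 , 2 ∷ 2 ∷ 2 ∷ dropLast (drop 1 δ) , 2 ∷ 2 ∷ dropLast γ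
unshift (suc d@(suc (suc (suc k))) , γ , δ) = d , d ∷ d ∷ d ∷ remove (suc k) (drop 1 δ) , d ∷ γ
unshift σ = σ

record Shifted (n : ℕ) (σ : Symbol) : Set where
  field
    e             : ℕ
    γ δ           : List ℕ
    image         : RankZeroSymbol n (suc e) γ δ
    γ₁<d          : part γ 1 < suc e
    δ₁≡d          : part δ 1 ≡ suc e
    unshift-image : unshift (suc e , γ , δ) ≡ σ

  open RankZeroSymbol image

  partition : Partition n
  partition = fromSymbol (suc e , γ , δ) , isPartition-fromSymbol isDurfeeSymbol weight

  partition-inU5 : InU5 (proj₁ partition)
  partition-inU5 = symbol⇒InU5 (proj₁ partition) (symbol-fromSymbol isDurfeeSymbol) balanced γ₁<d δ₁≡d

  σ≡unshift-symbol : σ ≡ unshift (symbol (proj₁ partition))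
  σ≡unshift-symbol = trans (sym unshift-image) (cong unshift (sym (symbol-fromSymbol isDurfeeSymbol)))

shift-one : ∀ {n α β} → RankZeroSymbol n 1 (1 ∷ 1 ∷ 1 ∷ α) (1 ∷ β) →
            Shifted n (1 , 1 ∷ 1 ∷ 1 ∷ α , 1 ∷ β)
shift-one {β = []} r = contradiction (RankZeroSymbol.balanced r) λ ()
shift-one {n} {α} {x ∷ β} r
  with ≤-antisym (All.head (drop⁺ 1 β-bounded)) (All.head (drop⁺ 1 β-positive))
  where open IsDurfeeSymbol (RankZeroSymbol.isDurfeeSymbol r)
... | refl = record
  { e = 1 ; γ = β ; δ = 2 ∷ α
  ; image = record
    { isDurfeeSymbol = record
      { α-descending = Descending-drop 2 β-descending
      ; α-positive   = drop⁺ 2 β-positive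
      ; α-bounded    = All.map m≤n⇒m≤1+n β≤1
      ; β-descending = Descending-∷ (m≤n⇒m≤1+n (All≤⇒part≤ α≤1 0)) (Descending-drop 3 α-descending)
      ; β-positive   = z<s ∷ drop⁺ 3 α-positive
      ; β-bounded    = ≤-refl ∷ All.map m≤n⇒m≤1+n α≤1
      }
    ; balanced = sym (suc-injective (suc-injective balanced))
    ; weight   = trans (regroup (sum α) (sum β)) weight
    }
  ; γ₁<d = s≤s (All≤⇒part≤ β≤1 0)
  ; δ₁≡d = refl
  ; unshift-image = refl
  }
  where
  open RankZeroSymbol r
  open IsDurfeeSymbol isDurfeeSymbol
  α≤1 = drop⁺ 3 α-bounded
  β≤1 = drop⁺ 2 β-bounded
  regroup : ∀ a b → 2 * 2 + b + (2 + a) ≡ 1 * 1 + (1 + (1 + (1 + a))) + (1 + (1 + b))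
  regroup = solve-∀

shift-two : ∀ {n α β} → RankZeroSymbol n 2 (2 ∷ 2 ∷ 2 ∷ α) (2 ∷ 2 ∷ β) →
            Shifted n (2 , 2 ∷ 2 ∷ 2 ∷ α , 2 ∷ 2 ∷ β)
shift-two {n} {α} {β} r = record
  { e = 2 ; γ = β ∷ʳ 1 ; δ = 3 ∷ α ∷ʳ 1
  ; image = record
    { isDurfeeSymbol = record
      { α-descending = Descending-∷ʳ β-pos (Descending-drop 2 β-descending)
      ; α-positive   = ∷ʳ⁺ β-pos z<s
      ; α-bounded    = All.map m≤n⇒m≤1+n β∷ʳ1≤2
      ; β-descending = Descending-∷ (All≤⇒part≤ α∷ʳ1≤3 0)
                         (Descending-∷ʳ α-pos (Descending-drop 3 α-descending))
      ; β-positive   = z<s ∷ ∷ʳ⁺ α-pos z<s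
      ; β-bounded    = ≤-refl ∷ α∷ʳ1≤3
      }
    ; balanced = begin
        length (β ∷ʳ 1)       ≡⟨ length-++ β ⟩
        length β + 1          ≡⟨ cong (_+ 1) (sym (suc-injective (suc-injective balanced))) ⟩
        suc (length α + 1)    ≡⟨ cong suc (length-++ α) ⟨
        suc (length (α ∷ʳ 1)) ∎
    ; weight = begin
        3 * 3 + sum (β ∷ʳ 1) + (3 + sum (α ∷ʳ 1))
          ≡⟨ cong₂ (λ b a → 3 * 3 + b + (3 + a)) (sum-++ β [ 1 ]) (sum-++ α [ 1 ]) ⟩
        3 * 3 + (sum β + 1) + (3 + (sum α + 1))
          ≡⟨ regroup (sum α) (sum β) ⟩
        2 * 2 + (2 + (2 + (2 + sum α))) + (2 + (2 + sum β))
          ≡⟨ weight ⟩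
        n ∎
    }
  ; γ₁<d = s≤s (All≤⇒part≤ β∷ʳ1≤2 0)
  ; δ₁≡d = refl
  ; unshift-image =
      cong₂ (λ α′ β′ → 2 , 2 ∷ 2 ∷ 2 ∷ α′ , 2 ∷ 2 ∷ β′) (dropLast-∷ʳ α 1) (dropLast-∷ʳ β 1)
  }
  where
  open RankZeroSymbol r
  open IsDurfeeSymbol isDurfeeSymbol
  open ≡-Reasoning
  α-pos = drop⁺ 3 α-positive
  β-pos = drop⁺ 2 β-positive
  β∷ʳ1≤2 = ∷ʳ⁺ (drop⁺ 2 β-bounded) (s≤s z≤n)
  α∷ʳ1≤3 = ∷ʳ⁺ (All.map m≤n⇒m≤1+n (drop⁺ 3 α-bounded)) (s≤s z≤n)
  regroup : ∀ a b → 3 * 3 + (b + 1) + (3 + (a + 1)) ≡ 2 * 2 + (2 + (2 + (2 + a))) + (2 + (2 + b))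
  regroup = solve-∀

shift-large : ∀ {n k α β} → let d = 3 + k in RankZeroSymbol n d (d ∷ d ∷ d ∷ α) (d ∷ β) →
              Shifted n (d , d ∷ d ∷ d ∷ α , d ∷ β)
shift-large {n} {k} {α} {β} r = record
  { e = 3 + k ; γ = β ; δ = 4 + k ∷ insert (suc k) α
  ; image = record
    { isDurfeeSymbol = record
      { α-descending = Descending-drop 1 β-descending
      ; α-positive   = drop⁺ 1 β-positive
      ; α-bounded    = All.map m≤n⇒m≤1+n β≤d
      ; β-descending = Descending-∷ (All≤⇒part≤ inserted≤d+1 0)
                         (insert-↗ (suc k) (Descending-drop 3 α-descending))
      ; β-positive   = z<s ∷ All-resp-↭ inserted↭ (z<s ∷ drop⁺ 3 α-positive)
      ; β-bounded    = ≤-refl ∷ inserted≤d+1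
      }
    ; balanced = trans (sym (suc-injective balanced)) (cong suc (↭-length inserted↭))
    ; weight   = begin
        (4 + k) * (4 + k) + sum β + (4 + k + sum (insert (suc k) α))
          ≡⟨ cong (λ a → (4 + k) * (4 + k) + sum β + (4 + k + a)) (sum-↭ (insert-↭ (suc k) α)) ⟩
        (4 + k) * (4 + k) + sum β + (4 + k + (suc k + sum α))
          ≡⟨ regroup k (sum α) (sum β) ⟩
        (3 + k) * (3 + k) + (3 + k + (3 + k + (3 + k + sum α))) + (3 + k + sum β)
          ≡⟨ weight ⟩
        n ∎
    }
  ; γ₁<d = s≤s (All≤⇒part≤ β≤d 0)
  ; δ₁≡d = refl
  ; unshift-image =
      cong (λ α′ → 3 + k , 3 + k ∷ 3 + k ∷ 3 + k ∷ α′ , 3 + k ∷ β) (remove-insert (suc k) α)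
  }
  where
  open RankZeroSymbol r
  open IsDurfeeSymbol isDurfeeSymbol
  open ≡-Reasoning
  β≤d = drop⁺ 1 β-bounded
  inserted↭ = ↭-sym (insert-↭ (suc k) α)
  inserted≤d+1 : All (_≤ 4 + k) (insert (suc k) α)
  inserted≤d+1 = All-resp-↭ inserted↭ (s≤s (m≤n+m k 3) ∷ All.map m≤n⇒m≤1+n (drop⁺ 3 α-bounded))
  regroup : ∀ k a b → (4 + k) * (4 + k) + b + (4 + k + (suc k + a)) ≡
                      (3 + k) * (3 + k) + (3 + k + (3 + k + (3 + k + a))) + (3 + k + b)
  regroup = solve-∀

-- InP5 λs and InP6 λs unfold to RankZero λs × P5Shape/P6Shape (durfee λs) (alpha λs) (beta λs).
P5Shape : ℕ → List ℕ → List ℕ → Set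
P5Shape d α β = ¬ d ≡ 2 × part β 1 ≡ d × part α 1 ≡ d × part α 2 ≡ d × part α 3 ≡ d

P6Shape : ℕ → List ℕ → List ℕ → Set
P6Shape d α β =
  d ≡ 2 × part β 1 ≡ 2 × part β 2 ≡ 2 × part α 1 ≡ 2 × part α 2 ≡ 2 × part α 3 ≡ 2

shift₅ : ∀ {n d α β} → 0 < d → RankZeroSymbol n d α β → P5Shape d α β → Shifted n (d , α , β)
shift₅ {α = α} {β} 0<d r (d≢2 , β₁ , α₁ , α₂ , α₃)
  with replicate-prefix 3 α 0<d (λ { zero → α₁ ; (suc zero) → α₂ ; (suc (suc zero)) → α₃ })
     | replicate-prefix 1 β 0<d (λ { zero → β₁ })
shift₅ {d = 1}                 _ r _ | _ , refl | _ , refl = shift-one r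
shift₅ {d = 2}                 _ _ (d≢2 , _) | _ | _ = contradiction refl d≢2
shift₅ {d = suc (suc (suc _))} _ r _ | _ , refl | _ , refl = shift-large r

shift₆ : ∀ {n d α β} → RankZeroSymbol n d α β → P6Shape d α β → Shifted n (d , α , β)
shift₆ {α = α} {β} r (refl , β₁ , β₂ , α₁ , α₂ , α₃)
  with replicate-prefix 3 α z<s (λ { zero → α₁ ; (suc zero) → α₂ ; (suc (suc zero)) → α₃ })
     | replicate-prefix 2 β z<s (λ { zero → β₁ ; (suc zero) → β₂ })
... | _ , refl | _ , refl = shift-two r

shift : ∀ {n} → 9 ≤ n → (x : P56 n) → Shifted n (symbol (proj₁ (proj₁ x)))
shift 9≤n ((_ , isPartition) , inj₁ (rankZero , shape)) =
  shift₅ 0<d (rankZeroSymbol isPartition rankZero 0<d) shape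
  where 0<d = 0<durfee isPartition (<-≤-trans z<s 9≤n)
shift 9≤n ((_ , isPartition) , inj₂ (rankZero , shape)) =
  shift₆ (rankZeroSymbol isPartition rankZero (0<durfee isPartition (<-≤-trans z<s 9≤n))) shape

lemma4p7 : (n : ℕ) → 9 ≤ n → Injection n
lemma4p7 n 9≤n = image , injective
  where
  image : P56 n → U5 n
  image x = Shifted.partition (shift 9≤n x) , Shifted.partition-inU5 (shift 9≤n x)
  injective : ∀ x y → proj₁ (proj₁ (image x)) ≡ proj₁ (proj₁ (image y)) →
              proj₁ (proj₁ x) ≡ proj₁ (proj₁ y)
  injective x@((_ , px) , _) y@((_ , py) , _) images≡ =
    symbol-injective (IsPartition.decreasing px) (IsPartition.decreasing py) (begin
      symbol (proj₁ (proj₁ x))                   ≡⟨ Shifted.σ≡unshift-symbol (shift 9≤n x) ⟩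
      unshift (symbol (proj₁ (proj₁ (image x)))) ≡⟨ cong (unshift ∘ symbol) images≡ ⟩
      unshift (symbol (proj₁ (proj₁ (image y)))) ≡⟨ Shifted.σ≡unshift-symbol (shift 9≤n y) ⟨
      symbol (proj₁ (proj₁ y))                   ∎)
    where open ≡-Reasoning
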